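{- For infinitely many positive integers $\omega$, there exist a chordal graph $G$ and a spanning bipartite subgraph $H$ of $G$ such that $\omega(G)=\omega$ and $\mathrm{BBC}_2(G,H)\geq \frac{5}{3}\omega$.
   Context: All graphs are finite and simple. A graph is chordal if it has no induced cycle of length at least $4$. For a positive integer $k$, $[k]=\{1,\dots,k\}$. Given a graph $G$, a subgraph $H$ of $G$, and positive integers $q,k$, a $q$-backbone $k$-colouring of $(G,H)$ is a map $c:V(G)\to[k]$ such that $c(u)\neq c(v)$ for every edge $uv\in E(G)$ and $|c(u)-c(v)|\geq q$ for every edge $uv\in E(H)$. $\mathrm{BBC}_q(G,H)$ is the minimum $k$ for which a $q$-backbone $k$-colouring of $(G,H)$ exists. $\omega(G)$ is the clique number of $G$. -}

module Defs where

open import Data.Nat using (ℕ; suc; _≤_; _+_; _*_; ∣_-_∣)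
open import Data.Fin using (Fin; toℕ)
open import Data.Bool using (Bool)
open import Data.Product using (Σ; _×_; ∃)
open import Data.Sum using (_⊎_)
open import Data.Empty using (⊥)
open import Relation.Nullary using (¬_)
open import Relation.Binary.PropositionalEquality using (_≡_; _≢_)
open import Function.Definitions using (Injective)
open import Function.Bundles using (_⇔_)

record Graph (n : ℕ) : Set₁ where
  field
    Adj    : Fin n → Fin n → Set
    sym    : ∀ {u v} → Adj u v → Adj v u
    irrefl : ∀ {u} → ¬ Adj u u
open Graph public

SpanningSubgraph : ∀ {n} → Graph n → Graph n → Set
SpanningSubgraph {n} H G = ∀ {u v : Fin n} → Adj H u v → Adj G u v

Bipartite : ∀ {n} → Graph n → Set
Bipartite {n} H = Σ (Fin n → Bool) λ side → ∀ {u v} → Adj H u v → side u ≢ side v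

CycSucc : (ℓ : ℕ) → Fin ℓ → Fin ℓ → Set
CycSucc ℓ i j = (suc (toℕ i) ≡ toℕ j) ⊎ ((suc (toℕ i) ≡ ℓ) × (toℕ j ≡ 0))

CycAdj : (ℓ : ℕ) → Fin ℓ → Fin ℓ → Set
CycAdj ℓ i j = CycSucc ℓ i j ⊎ CycSucc ℓ j i

InducedCycle : ∀ {n} → Graph n → (ℓ : ℕ) → (Fin ℓ → Fin n) → Set
InducedCycle G ℓ c = Injective _≡_ _≡_ c × (∀ i j → Adj G (c i) (c j) ⇔ CycAdj ℓ i j)

Chordal : ∀ {n} → Graph n → Set
Chordal {n} G = ∀ (ℓ : ℕ) → 4 ≤ ℓ → (c : Fin ℓ → Fin n) → ¬ InducedCycle G ℓ c

IsClique : ∀ {n} → Graph n → (m : ℕ) → (Fin m → Fin n) → Set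
IsClique G m f = Injective _≡_ _≡_ f × (∀ i j → i ≢ j → Adj G (f i) (f j))

CliqueNumber : ∀ {n} → Graph n → ℕ → Set
CliqueNumber {n} G w =
  (Σ (Fin w → Fin n) (IsClique G w)) ×
  (∀ (m : ℕ) (f : Fin m → Fin n) → IsClique G m f → m ≤ w)

BackboneColouring : ∀ {n} → ℕ → Graph n → Graph n → ℕ → (Fin n → ℕ) → Set
BackboneColouring {n} q G H k c =
  (∀ v → 1 ≤ c v × c v ≤ k) ×
  (∀ {u v} → Adj G u v → c u ≢ c v) ×
  (∀ {u v} → Adj H u v → q ≤ ∣ c u - c v ∣)

-- BBC_q(G,H) ≥ r/s (rational bound), unfolded from the minimum:
-- every k admitting a q-backbone k-colouring satisfies r ≤ s·k.
BBC≥ : ∀ {n} → ℕ → Graph n → Graph n → (r s : ℕ) → Set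
BBC≥ {n} q G H r s =
  ∀ (k : ℕ) (c : Fin n → ℕ) → BackboneColouring q G H k c → r ≤ s * k

-- G consists of a clique K on 3t vertices together with, for every t-tuple T of
-- vertices of K, a clique Q_T on s new vertices joined completely to T; H keeps
-- only the edges between each T and its Q_T.  The vertices of the Q_T are
-- simplicial and K is a clique, so G is chordal, and for s ≤ 2t every clique
-- lies in K or in some T ∪ Q_T, so ω(G) = 3t.  In a 2-backbone colouring the 3t
-- colours on K are distinct; listing them in increasing order and taking the
-- middle one of each consecutive triple gives t centres c whose windows
-- {c - 1, c, c + 1} are disjoint and lie in [1, k].  Let T be the vertices with
-- these colours: the s distinct colours on Q_T are at distance at least 2 from
-- every centre, hence outside all windows, so k ≥ 3t + s.  Take s = 2t.
module Submission where

open import Defs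
open import Data.Nat using (ℕ; _≤_; _*_)
open import Data.Product using (Σ; _×_)

open import Data.Nat using (zero; suc; _+_; _∸_; _^_; _<_; z≤n; s≤s; s≤s⁻¹; ∣_-_∣)
open import Data.Nat.Properties
open import Data.Nat.Tactic.RingSolver using (solve-∀)
open import Data.Fin as Fin using (Fin; toℕ; fromℕ; fromℕ<; splitAt; join; finToFun; funToFin)
open import Data.Fin.Properties
  using (any?; toℕ-injective; toℕ-fromℕ; toℕ-fromℕ<; toℕ<n; splitAt-join;
         injective⇒≤; +↔⊎; *↔×; finToFun-funToFin)
  renaming (<-cmp to <-cmpᶠ)
open import Data.Product using (_,_; proj₁; proj₂; ∃)
open import Data.Product.Properties using (,-injectiveʳ)
open import Data.Sum using (_⊎_; inj₁; inj₂)
open import Data.Sum.Properties using (inj₁-injective; inj₂-injective)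
open import Data.Sum.Function.Propositional using (_⊎-↔_)
open import Data.Bool using (Bool; true; false)
open import Data.Empty using (⊥; ⊥-elim)
open import Data.List using (List; _∷_; length; filter; upTo; lookup)
open import Data.List.Membership.Propositional using (_∈_)
open import Data.List.Membership.Propositional.Properties using (∈-filter⁺; ∈-filter⁻; ∈-upTo⁺)
open import Data.List.Relation.Unary.All as All using (All; _∷_)
open import Data.List.Relation.Unary.AllPairs using (AllPairs; _∷_)
import Data.List.Relation.Unary.AllPairs.Properties as AllPairs
open import Data.List.Relation.Unary.Any as Any using (here; there)
open import Data.List.Relation.Unary.Any.Properties using (lookup-index)
open import Function.Base using (_∘_; id)
open import Function.Bundles using (_↔_; Inverse; Injection; Equivalence)
open import Function.Definitions using (Injective)
open import Function.Properties.Inverse using (↔-refl; ↔-sym; ↔-trans; Inverse⇒Injection)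
open import Relation.Binary.Definitions using (tri<; tri≈; tri>)
open import Relation.Binary.PropositionalEquality as ≡
  using (_≡_; _≢_; refl; cong; subst; subst₂; trans)
open import Relation.Nullary using (¬_; Dec; yes; no)

injective-into-image⇒≤ : ∀ {a} {A : Set a} {m n} {f : Fin m → A} (g : Fin n → A) →
  Injective _≡_ _≡_ f → (∀ i → ∃ λ j → f i ≡ g j) → m ≤ n
injective-into-image⇒≤ g f-inj image =
  injective⇒≤ λ {i} {i′} e →
    f-inj (trans (proj₂ (image i)) (trans (cong g e) (≡.sym (proj₂ (image i′)))))

injective-colours⇒≤ : ∀ {m k} (col : Fin m → ℕ) → Injective _≡_ _≡_ col →
  (∀ i → 1 ≤ col i × col i ≤ k) → m ≤ k
injective-colours⇒≤ {k = k} col col-inj range =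
  injective-into-image⇒≤ (λ (x : Fin k) → suc (toℕ x)) col-inj image
  where
  image : ∀ i → ∃ λ (x : Fin k) → col i ≡ suc (toℕ x)
  image i with col i | range i
  ... | suc c | _ , c<k = fromℕ< c<k , cong suc (≡.sym (toℕ-fromℕ< c<k))

proper⇒injective-on-clique : ∀ {n m} {G : Graph n} {f : Fin m → Fin n} (col : Fin n → ℕ) →
  IsClique G m f → (∀ {u v} → Adj G u v → col u ≢ col v) → Injective _≡_ _≡_ (col ∘ f)
proper⇒injective-on-clique col (_ , adjacent) proper {i} {j} e with i Fin.≟ j
... | yes i≡j = i≡j
... | no i≢j  = ⊥-elim (proper (adjacent i j i≢j) e)

-- The window of a centre c is {c - 1, c, c + 1}; these windows lie in [lo, hi]
-- and are pairwise disjoint.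
record DisjointWindows (lo hi : ℕ) {t} (centre : Fin t → ℕ) : Set where
  field
    lo<centre : ∀ j → lo < centre j
    centre<hi : ∀ j → centre j < hi
    spaced    : ∀ {i j} → i Fin.< j → 3 + centre i ≤ centre j

window-in-range : ∀ {lo hi c d} → lo < c → c < hi → d ≤ 2 → lo ≤ c ∸ 1 + d × c ∸ 1 + d ≤ hi
window-in-range {c = suc c} {d} (s≤s lo≤c) c<hi d≤2 =
  ≤-trans lo≤c (m≤m+n c d) , ≤-trans (+-monoʳ-≤ c d≤2) (≤-trans (≤-reflexive (+-comm c 2)) c<hi)

window-below : ∀ {c c′ d d′} → 0 < c → 3 + c ≤ c′ → d ≤ 2 → c ∸ 1 + d < c′ ∸ 1 + d′
window-below {suc c} {suc c′} {d} {d′} _ (s≤s 3+c≤c′) d≤2 = begin-strict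
  c + d   ≤⟨ +-monoʳ-≤ c d≤2 ⟩
  c + 2   ≡⟨ +-comm c 2 ⟩
  2 + c   <⟨ 3+c≤c′ ⟩
  c′      ≤⟨ m≤m+n c′ d′ ⟩
  c′ + d′ ∎
  where open ≤-Reasoning

window-near-centre : ∀ c {d} → d ≤ 2 → ∣ suc c - c + d ∣ ≤ 1
window-near-centre zero    z≤n               = s≤s z≤n
window-near-centre zero    (s≤s z≤n)         = z≤n
window-near-centre zero    (s≤s (s≤s z≤n))   = s≤s z≤n
window-near-centre (suc c) d≤2               = window-near-centre c d≤2

window-avoids-far : ∀ {c d v} → 0 < c → d ≤ 2 → 2 ≤ ∣ c - v ∣ → c ∸ 1 + d ≢ v
window-avoids-far {suc c} _ d≤2 far refl = <⇒≱ far (window-near-centre c d≤2)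

windows-and-colours⇒≤ : ∀ {t s k} {centre : Fin t → ℕ} → DisjointWindows 1 k centre →
  (b : Fin s → ℕ) → Injective _≡_ _≡_ b → (∀ q → 1 ≤ b q × b q ≤ k) →
  (∀ j q → 2 ≤ ∣ centre j - b q ∣) → t * 3 + s ≤ k
windows-and-colours⇒≤ {t} {s} {k} {centre} windows b b-inj b-range far =
  injective-colours⇒≤ (colour ∘ to)
    (Injection.injective (Inverse⇒Injection index) ∘ colour-injective _ _) (range ∘ to)
  where
  open DisjointWindows windows
  index : Fin (t * 3 + s) ↔ ((Fin t × Fin 3) ⊎ Fin s)
  index = ↔-trans +↔⊎ (*↔× ⊎-↔ ↔-refl)
  open Inverse index using (to)

  colour : (Fin t × Fin 3) ⊎ Fin s → ℕ
  colour (inj₁ (j , d)) = centre j ∸ 1 + toℕ d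
  colour (inj₂ q)       = b q

  d≤2 : (d : Fin 3) → toℕ d ≤ 2
  d≤2 d = s≤s⁻¹ (toℕ<n d)

  0<centre : ∀ j → 0 < centre j
  0<centre j = <-trans (s≤s z≤n) (lo<centre j)

  range : ∀ x → 1 ≤ colour x × colour x ≤ k
  range (inj₁ (j , d)) = window-in-range (lo<centre j) (centre<hi j) (d≤2 d)
  range (inj₂ q)       = b-range q

  colour-injective : ∀ x y → colour x ≡ colour y → x ≡ y
  colour-injective (inj₁ (i , d)) (inj₁ (j , e)) eq with <-cmpᶠ i j
  ... | tri< i<j _ _ = ⊥-elim (<⇒≢ (window-below (0<centre i) (spaced i<j) (d≤2 d)) eq)
  ... | tri> _ _ j<i = ⊥-elim (<⇒≢ (window-below (0<centre j) (spaced j<i) (d≤2 e)) (≡.sym eq))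
  ... | tri≈ _ refl _ = cong (λ d → inj₁ (i , d)) (toℕ-injective (+-cancelˡ-≡ (centre i ∸ 1) _ _ eq))
  colour-injective (inj₁ (j , d)) (inj₂ q) eq =
    ⊥-elim (window-avoids-far (0<centre j) (d≤2 d) (far j q) eq)
  colour-injective (inj₂ q) (inj₁ (j , d)) eq =
    ⊥-elim (window-avoids-far (0<centre j) (d≤2 d) (far j q) (≡.sym eq))
  colour-injective (inj₂ q) (inj₂ q′) eq = cong inj₂ (b-inj eq)

middles-of-triples : ∀ t {lo hi} {xs : List ℕ} → AllPairs _<_ xs → All (lo ≤_) xs → All (_≤ hi) xs →
  t * 3 ≤ length xs → Σ (Fin t → ℕ) λ c → (∀ j → c j ∈ xs) × DisjointWindows lo hi c
middles-of-triples zero _ _ _ _ =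
  (λ ()) , (λ ()) , record { lo<centre = λ () ; centre<hi = λ () ; spaced = λ { {()} } }
middles-of-triples (suc t) {lo} {hi} {x₀ ∷ x₁ ∷ x₂ ∷ xs}
  ((x₀<x₁ ∷ _) ∷ (x₁<x₂ ∷ _) ∷ x₂<xs ∷ sorted) (lo≤x₀ ∷ _) (_ ∷ _ ∷ x₂≤hi ∷ ≤hi) (s≤s (s≤s (s≤s len)))
  with middles-of-triples t sorted x₂<xs ≤hi len
... | c , c∈xs , windows = centre , centre∈ , record
  { lo<centre = lo<centre′ ; centre<hi = centre<hi′ ; spaced = spaced′ }
  where
  open DisjointWindows windows
  centre : Fin (suc t) → ℕ
  centre Fin.zero    = x₁
  centre (Fin.suc j) = c j

  centre∈ : ∀ j → centre j ∈ x₀ ∷ x₁ ∷ x₂ ∷ xs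
  centre∈ Fin.zero    = there (here refl)
  centre∈ (Fin.suc j) = there (there (there (c∈xs j)))

  3+x₁≤c : ∀ j → 3 + x₁ ≤ c j
  3+x₁≤c j = ≤-trans (s≤s (s≤s x₁<x₂)) (lo<centre j)

  lo<centre′ : ∀ j → lo < centre j
  lo<centre′ Fin.zero    = ≤-<-trans lo≤x₀ x₀<x₁
  lo<centre′ (Fin.suc j) = <-trans (≤-<-trans lo≤x₀ x₀<x₁) (≤-trans (m≤n+m (suc x₁) 2) (3+x₁≤c j))

  centre<hi′ : ∀ j → centre j < hi
  centre<hi′ Fin.zero    = ≤-trans x₁<x₂ x₂≤hi
  centre<hi′ (Fin.suc j) = centre<hi j

  spaced′ : ∀ {i j} → i Fin.< j → 3 + centre i ≤ centre j
  spaced′ {Fin.zero}  {Fin.suc j} _         = 3+x₁≤c j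
  spaced′ {Fin.suc i} {Fin.suc j} (s≤s i<j) = spaced i<j

distinct-colours-contain-windows : ∀ t {k} (a : Fin (t * 3) → ℕ) → Injective _≡_ _≡_ a →
  (∀ i → 1 ≤ a i × a i ≤ k) →
  Σ (Fin t → ℕ) λ c → (∀ j → ∃ λ i → a i ≡ c j) × DisjointWindows 1 k c
distinct-colours-contain-windows t {k} a a-inj range =
  let c , c∈used , windows = middles-of-triples t sorted (All.map proj₁ bounds) (All.map proj₂ bounds) long
  in c , (λ j → proj₂ (∈-filter⁻ used? (c∈used j))) , windows
  where
  used? : ∀ v → Dec (∃ λ i → a i ≡ v)
  used? v = any? (λ i → a i ≟ v)

  used : List ℕ
  used = filter used? (upTo (suc k))

  sorted : AllPairs _<_ used
  sorted = AllPairs.filter⁺ used? (AllPairs.applyUpTo⁺₁ id (suc k) (λ i<j _ → i<j))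

  bounds : All (λ v → 1 ≤ v × v ≤ k) used
  bounds = All.tabulate λ v∈ → used-range (proj₂ (∈-filter⁻ used? v∈))
    where
    used-range : ∀ {v} → ∃ (λ i → a i ≡ v) → 1 ≤ v × v ≤ k
    used-range (i , refl) = range i

  long : t * 3 ≤ length used
  long = injective-into-image⇒≤ (lookup used) a-inj λ i →
    let a∈used = ∈-filter⁺ used? (∈-upTo⁺ (s≤s (proj₂ (range i)))) (i , refl)
    in Any.index a∈used , lookup-index a∈used

Simplicial : ∀ {n} → Graph n → Fin n → Set
Simplicial G v = ∀ {x y} → Adj G v x → Adj G v y → x ≢ y → Adj G x y

-- In an induced cycle of length ≥ 4 the vertices at positions 0 and 2 are not
-- simplicial, so both would lie in the clique and be adjacent.
simplicial-or-clique⇒chordal : ∀ {n} (G : Graph n) (C : Fin n → Set) →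
  (∀ {u v} → C u → C v → u ≢ v → Adj G u v) → (∀ v → Simplicial G v ⊎ C v) → Chordal G
simplicial-or-clique⇒chordal G C clique simplicial-or-C
  ℓ@(suc (suc (suc (suc m)))) (s≤s (s≤s (s≤s (s≤s _)))) c (c-inj , induced) =
  ¬0~2 (to (induced p₀ p₂) (clique (in-C p₀ pₗ p₁ 0~ℓ 0~1 (λ ()) ¬ℓ~1)
                                   (in-C p₂ p₁ p₃ 2~1 2~3 (λ ()) ¬1~3)
                                   (λ e → p₀≢p₂ (c-inj e))))
  where
  open Equivalence using (to; from)
  p₀ p₁ p₂ p₃ pₗ : Fin ℓ
  p₀ = Fin.zero
  p₁ = Fin.suc Fin.zero
  p₂ = Fin.suc (Fin.suc Fin.zero)
  p₃ = Fin.suc (Fin.suc (Fin.suc Fin.zero))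
  pₗ = fromℕ (3 + m)

  in-C : ∀ x y z → CycAdj ℓ x y → CycAdj ℓ x z → y ≢ z → ¬ CycAdj ℓ y z → C (c x)
  in-C x y z x~y x~z y≢z y≁z with simplicial-or-C (c x)
  ... | inj₁ simplicial = ⊥-elim (y≁z (to (induced y z)
          (simplicial (from (induced x y) x~y) (from (induced x z) x~z) (y≢z ∘ c-inj))))
  ... | inj₂ in-C = in-C

  p₀≢p₂ : p₀ ≢ p₂
  p₀≢p₂ ()
  0~ℓ : CycAdj ℓ p₀ pₗ
  0~ℓ = inj₂ (inj₂ (cong suc (toℕ-fromℕ (3 + m)) , refl))
  0~1 : CycAdj ℓ p₀ p₁
  0~1 = inj₁ (inj₁ refl)
  2~1 : CycAdj ℓ p₂ p₁
  2~1 = inj₂ (inj₁ refl)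
  2~3 : CycAdj ℓ p₂ p₃
  2~3 = inj₁ (inj₁ refl)
  ¬ℓ~1 : ¬ CycAdj ℓ pₗ p₁
  ¬ℓ~1 (inj₁ (inj₁ ()))
  ¬ℓ~1 (inj₁ (inj₂ (_ , ())))
  ¬ℓ~1 (inj₂ (inj₁ ()))
  ¬ℓ~1 (inj₂ (inj₂ (() , _)))
  ¬1~3 : ¬ CycAdj ℓ p₁ p₃
  ¬1~3 (inj₁ (inj₁ ()))
  ¬1~3 (inj₁ (inj₂ (() , _)))
  ¬1~3 (inj₂ (inj₁ ()))
  ¬1~3 (inj₂ (inj₂ (_ , ())))
  ¬0~2 : ¬ CycAdj ℓ p₀ p₂
  ¬0~2 (inj₁ (inj₁ ()))
  ¬0~2 (inj₁ (inj₂ (() , _)))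
  ¬0~2 (inj₂ (inj₁ ()))
  ¬0~2 (inj₂ (inj₂ (() , _)))

module Construction (t s : ℕ) where

  w : ℕ
  w = t * 3

  Tuple : Set
  Tuple = Fin (w ^ t)

  entry : Tuple → Fin t → Fin w
  entry = finToFun {w} {t}

  Vertex : Set
  Vertex = Fin w ⊎ (Tuple × Fin s)

  pattern core a    = inj₁ a
  pattern petal g q = inj₂ (g , q)

  _∈ᵗ_ : Fin w → Tuple → Set
  a ∈ᵗ g = ∃ λ j → entry g j ≡ a

  _~_ : Vertex → Vertex → Set
  core a    ~ core b      = a ≢ b
  core a    ~ petal g _   = a ∈ᵗ g
  petal g _ ~ core a      = a ∈ᵗ g
  petal g q ~ petal g′ q′ = g ≡ g′ × q ≢ q′

  _~ᴴ_ : Vertex → Vertex → Set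
  core a    ~ᴴ petal g _ = a ∈ᵗ g
  petal g _ ~ᴴ core a    = a ∈ᵗ g
  _         ~ᴴ _         = ⊥

  ~-sym : ∀ {x y} → x ~ y → y ~ x
  ~-sym {core _}    {core _}    a≢b        = a≢b ∘ ≡.sym
  ~-sym {core _}    {petal _ _} a∈g        = a∈g
  ~-sym {petal _ _} {core _}    a∈g        = a∈g
  ~-sym {petal _ _} {petal _ _} (g≡g′ , q≢q′) = ≡.sym g≡g′ , q≢q′ ∘ ≡.sym

  ~-irrefl : ∀ {x} → ¬ x ~ x
  ~-irrefl {core _}    a≢a       = a≢a refl
  ~-irrefl {petal _ _} (_ , q≢q) = q≢q refl

  ~ᴴ-sym : ∀ {x y} → x ~ᴴ y → y ~ᴴ x
  ~ᴴ-sym {core _}    {petal _ _} a∈g = a∈g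
  ~ᴴ-sym {petal _ _} {core _}    a∈g = a∈g

  ~ᴴ-irrefl : ∀ x → ¬ x ~ᴴ x
  ~ᴴ-irrefl (core _)    ()
  ~ᴴ-irrefl (petal _ _) ()

  ~ᴴ⇒~ : ∀ {x y} → x ~ᴴ y → x ~ y
  ~ᴴ⇒~ {core _}    {petal _ _} a∈g = a∈g
  ~ᴴ⇒~ {petal _ _} {core _}    a∈g = a∈g

  petal-simplicial : ∀ {g q y z} → petal g q ~ y → petal g q ~ z → y ≢ z → y ~ z
  petal-simplicial {y = core _}    {core _}    _           _           y≢z = y≢z ∘ cong inj₁
  petal-simplicial {y = core _}    {petal _ _} a∈g         (refl , _)  _   = a∈g
  petal-simplicial {y = petal _ _} {core _}    (refl , _)  a∈g         _   = a∈g
  petal-simplicial {y = petal _ _} {petal _ _} (refl , _)  (refl , _)  y≢z = refl , y≢z ∘ cong (petal _)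

  attached : Tuple → Fin t ⊎ Fin s → Vertex
  attached g (inj₁ j) = core (entry g j)
  attached g (inj₂ q) = petal g q

  ~petal⇒attached : ∀ {x g q} → x ~ petal g q → ∃ λ b → x ≡ attached g b
  ~petal⇒attached {core _}    (j , refl) = inj₁ j , refl
  ~petal⇒attached {petal _ q} (refl , _) = inj₂ q , refl

  n : ℕ
  n = w + w ^ t * s

  vertices : Fin n ↔ Vertex
  vertices = ↔-trans +↔⊎ (↔-refl ⊎-↔ *↔×)

  open Inverse vertices using () renaming (to to decode; from to encode; strictlyInverseˡ to decode-encode)

  decode-injective : Injective _≡_ _≡_ decode
  decode-injective = Injection.injective (Inverse⇒Injection vertices)

  encode-injective : Injective _≡_ _≡_ encode
  encode-injective = Injection.injective (Inverse⇒Injection (↔-sym vertices))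

  G : Graph n
  G = record { Adj = λ u v → decode u ~ decode v ; sym = ~-sym ; irrefl = ~-irrefl }

  H : Graph n
  H = record
    { Adj = λ u v → decode u ~ᴴ decode v ; sym = ~ᴴ-sym ; irrefl = λ {u} → ~ᴴ-irrefl (decode u) }

  encode-~ : ∀ {x y} → x ~ y → Adj G (encode x) (encode y)
  encode-~ {x} {y} = subst₂ _~_ (≡.sym (decode-encode x)) (≡.sym (decode-encode y))

  encode-~ᴴ : ∀ {x y} → x ~ᴴ y → Adj H (encode x) (encode y)
  encode-~ᴴ {x} {y} = subst₂ _~ᴴ_ (≡.sym (decode-encode x)) (≡.sym (decode-encode y))

  spanning : SpanningSubgraph H G
  spanning {u} {v} = ~ᴴ⇒~ {decode u} {decode v}

  bipartite : Bipartite H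
  bipartite = isCore ∘ decode , λ {u} {v} → sides-differ (decode u) (decode v)
    where
    isCore : Vertex → Bool
    isCore (core _)    = true
    isCore (petal _ _) = false

    sides-differ : ∀ x y → x ~ᴴ y → isCore x ≢ isCore y
    sides-differ (core _)    (petal _ _) _ ()
    sides-differ (petal _ _) (core _)    _ ()

  IsCore : Fin n → Set
  IsCore u = ∃ λ a → decode u ≡ core a

  chordal : Chordal G
  chordal = simplicial-or-clique⇒chordal G IsCore cores-adjacent simplicial-or-core
    where
    cores-adjacent : ∀ {u v} → IsCore u → IsCore v → u ≢ v → Adj G u v
    cores-adjacent {u} {v} (a , ua) (b , vb) u≢v =
      subst₂ _~_ (≡.sym ua) (≡.sym vb) λ a≡b →
        u≢v (decode-injective (trans ua (trans (cong core a≡b) (≡.sym vb))))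

    simplicial-or-core : ∀ u → Simplicial G u ⊎ IsCore u
    simplicial-or-core u with decode u
    ... | core a    = inj₂ (a , refl)
    ... | petal g q = inj₁ λ ux uy x≢y → petal-simplicial ux uy (x≢y ∘ decode-injective)

  coreVertex : Fin w → Fin n
  coreVertex a = encode (core a)

  petalVertex : Tuple → Fin s → Fin n
  petalVertex g q = encode (petal g q)

  core-clique : IsClique G w coreVertex
  core-clique = (λ e → inj₁-injective (encode-injective e)) ,
                λ a b a≢b → encode-~ {core a} {core b} a≢b

  petal-clique : ∀ g → IsClique G s (petalVertex g)
  petal-clique g = (λ e → ,-injectiveʳ (inj₂-injective (encode-injective e))) ,
                   λ q q′ q≢q′ → encode-~ {petal g q} {petal g q′} (refl , q≢q′)

  petal? : (x : Vertex) → Dec (∃ λ gq → x ≡ inj₂ gq)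
  petal? (core _)    = no λ ()
  petal? (petal g q) = yes ((g , q) , refl)

  clique-bound : t + s ≤ w → ∀ m f → IsClique G m f → m ≤ w
  clique-bound t+s≤w m f (f-inj , adjacent) with any? (λ i → petal? (decode (f i)))
  ... | no no-petal = injective-into-image⇒≤ core (λ e → f-inj (decode-injective e)) in-core
    where
    in-core : ∀ i → ∃ λ a → decode (f i) ≡ core a
    in-core i with decode (f i) in fi
    ... | core a    = a , refl
    ... | petal g q = ⊥-elim (no-petal (i , (g , q) , fi))
  ... | yes (i₀ , (g , q₀) , fi₀) =
    ≤-trans (injective-into-image⇒≤ (attached g ∘ splitAt t) (λ e → f-inj (decode-injective e))
               in-closed-neighbourhood)
            t+s≤w
    where
    in-closed-neighbourhood : ∀ i → ∃ λ b → decode (f i) ≡ attached g (splitAt t b)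
    in-closed-neighbourhood i with i Fin.≟ i₀
    ... | yes refl = join t s (inj₂ q₀) , trans fi₀ (cong (attached g) (≡.sym (splitAt-join t s (inj₂ q₀))))
    ... | no i≢i₀ with ~petal⇒attached (subst (decode (f i) ~_) fi₀ (adjacent i i₀ i≢i₀))
    ... | b , fi = join t s b , trans fi (cong (attached g) (≡.sym (splitAt-join t s b)))

  clique-number : t + s ≤ w → CliqueNumber G w
  clique-number t+s≤w = (coreVertex , core-clique) , clique-bound t+s≤w

  backbone-colours≥ : ∀ k col → BackboneColouring 2 G H k col → t * 3 + s ≤ k
  backbone-colours≥ k col (range , proper , backbone) =
    let centre , coloured , windows =
          distinct-colours-contain-windows t (col ∘ coreVertex)
            (proper⇒injective-on-clique {G = G} col core-clique proper) (range ∘ coreVertex)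
        tuple = proj₁ ∘ coloured
        g = funToFin tuple
        far : ∀ j q → 2 ≤ ∣ centre j - col (petalVertex g q) ∣
        far j q = subst (λ c → 2 ≤ ∣ c - col (petalVertex g q) ∣) (proj₂ (coloured j))
                    (backbone (encode-~ᴴ {core (tuple j)} {petal g q} (j , finToFun-funToFin tuple j)))
    in windows-and-colours⇒≤ windows (col ∘ petalVertex g)
         (proper⇒injective-on-clique {G = G} col (petal-clique g) proper) (range ∘ petalVertex g) far

proposition1 : ∀ (N : ℕ) → Σ ℕ λ w → (N ≤ w) × (1 ≤ w) ×
    Σ ℕ λ n → Σ (Graph n) λ G → Σ (Graph n) λ H →
      Chordal G × SpanningSubgraph H G × Bipartite H ×
      CliqueNumber G w × BBC≥ 2 G H (5 * w) 3
proposition1 N =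
  w , ≤-trans (n≤1+n N) t≤w , ≤-trans (s≤s z≤n) t≤w ,
  n , G , H , chordal , (λ {u} {v} → spanning {u} {v}) , bipartite ,
  clique-number (≤-reflexive (x+2x≡3x t)) , five-thirds
  where
  t = suc N
  open Construction t (t * 2)

  t≤w : t ≤ w
  t≤w = m≤m*n t 3

  x+2x≡3x : ∀ x → x + x * 2 ≡ x * 3
  x+2x≡3x = solve-∀

  5[3x]≡3[3x+2x] : ∀ x → 5 * (x * 3) ≡ 3 * (x * 3 + x * 2)
  5[3x]≡3[3x+2x] = solve-∀

  five-thirds : BBC≥ 2 G H (5 * w) 3
  five-thirds k col colouring =
    ≤-trans (≤-reflexive (5[3x]≡3[3x+2x] t)) (*-monoʳ-≤ 3 (backbone-colours≥ k col colouring))
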